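{- For every odd encoding $\alpha$, the quotient sequence given by $\alpha$ and the quotient sequence given by $\phi(\alpha)$ are equal.
   Context: Fix $n \geq 0$. For a vector $\vec b = [b_0, \ldots, b_{2n}]$ of non-negative integers, let $W(\vec b)$ be the binary word $B_0 B_1 \cdots B_{2n}$, where $B_j = (01)^{b_j+1}$ for $j$ even and $B_j = (10)^{b_j+1}$ for $j$ odd (blocks numbered from $0$). An encoding $(\vec b; s, l; t, m)$ with $0 \le s \le t \le 2n$, $0 \leq l < 2(b_s+1)$, $0 \leq m < 2(b_t+1)$ designates the contiguous substring (subsequence) of $W(\vec b)$ starting in block $s$ immediately after its first $l$ symbols and ending in block $t$ immediately before its last $m$ symbols. If this subsequence occupies positions $p$ through $q$ of $W(\vec b)$, the quotient sequence given by the encoding is the word obtained from $W(\vec b)$ by deleting the symbols in positions strictly between $p$ and $q$ (the first and last symbols of the subsequence are kept). An odd encoding is an encoding with $s < t$, $s$ and $t$ of different parity, and $l$ and $m$ of different parity. The map $\phi$ on odd encodings is $\phi(\vec b; s, l; t, m) = (\vec c; s, m; t, l)$, where $c_i = b_i$ for $i < s$ or $i > t$ and $c_i = b_{s+t-i}$ for $s \leq i \leq t$; its quotient sequence is taken in $W(\vec c)$. -}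

module Defs where

open import Data.Nat using (ℕ; _<_; zero; suc; _+_; _*_; _∸_; _≤ᵇ_; _%_)
open import Data.Bool using (Bool; true; false; if_then_else_; _∧_)
open import Data.Fin using (Fin; toℕ)
import Data.Fin as Fin
open import Relation.Nullary using (¬_)
open import Relation.Binary.PropositionalEquality using (_≡_)
open import Data.List using (List; []; _∷_; _++_; concat; take; drop; length; tabulate)

-- Symbols: 0 is false, 1 is true.

rep : ℕ → Bool → Bool → List Bool
rep zero    x y = []
rep (suc k) x y = x ∷ y ∷ rep k x y

block : ℕ → ℕ → List Bool
block j bj with j % 2
... | zero  = rep (suc bj) false true
... | suc _ = rep (suc bj) true false

blocks : (n : ℕ) → (Fin (suc (2 * n)) → ℕ) → List (List Bool)
blocks n b = tabulate (λ i → block (toℕ i) (b i))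

W : (n : ℕ) → (Fin (suc (2 * n)) → ℕ) → List Bool
W n b = concat (blocks n b)

offset : (n : ℕ) → (Fin (suc (2 * n)) → ℕ) → ℕ → ℕ
offset n b s = length (concat (take s (blocks n b)))

-- Quotient sequence of the encoding (b; s, l; t, m):
-- the subsequence occupies positions p = offset s + l through
-- q = offset t + 2 (b_t + 1) ∸ m ∸ 1; we keep positions ≤ p and ≥ q.
quotientSeq : (n : ℕ) → (b : Fin (suc (2 * n)) → ℕ) →
              Fin (suc (2 * n)) → ℕ → Fin (suc (2 * n)) → ℕ → List Bool
quotientSeq n b s l t m =
  let p = offset n b (toℕ s) + l
      q = offset n b (toℕ t) + 2 * suc (b t) ∸ m ∸ 1
  in take (suc p) (W n b) ++ drop q (W n b)

revIdx : ℕ → ℕ → ℕ → ℕ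
revIdx s t i = if (s ≤ᵇ i) ∧ (i ≤ᵇ t) then s + t ∸ i else i

-- lookup of b at a natural-number index (default 0 out of range; never used
-- out of range since revIdx maps [0,2n] into itself)
lookupℕ : (N : ℕ) → (Fin N → ℕ) → ℕ → ℕ
lookupℕ zero    b k       = 0
lookupℕ (suc N) b zero    = b Fin.zero
lookupℕ (suc N) b (suc k) = lookupℕ N (λ i → b (Fin.suc i)) k

-- the vector c of φ(b; s, l; t, m)
reverseSeg : (n : ℕ) → (Fin (suc (2 * n)) → ℕ) →
             Fin (suc (2 * n)) → Fin (suc (2 * n)) → (Fin (suc (2 * n)) → ℕ)
reverseSeg n b s t i = lookupℕ (suc (2 * n)) b (revIdx (toℕ s) (toℕ t) (toℕ i))

record OddEncoding (n : ℕ) (b : Fin (suc (2 * n)) → ℕ)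
                   (s : Fin (suc (2 * n))) (l : ℕ) (t : Fin (suc (2 * n))) (m : ℕ) : Set where
  field
    l-bound  : l < 2 * suc (b s)
    m-bound  : m < 2 * suc (b t)
    s<t      : toℕ s < toℕ t
    st-parity : ¬ (toℕ s % 2 ≡ toℕ t % 2)
    lm-parity : ¬ (l % 2 ≡ m % 2)

-- Blocks B_s and B_t have indices of opposite parity, so they are alternating words
-- starting with opposite symbols.  The quotient keeps the blocks before s and after t
-- untouched, and between them the first l+1 symbols of B_s followed by the last m+1
-- symbols of B_t.  Because l and m have opposite parity these two pieces fit together
-- into the alternating word of length l+m+2 that starts like B_s, whatever b_s and b_t
-- are.  The map φ fixes the outer blocks, keeps the first symbol of block s, and swaps
-- (b_s, l) with (b_t, m); since l+m+2 is symmetric the middle part does not change.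
module Submission where

open import Defs
open import Data.Nat using (ℕ; suc; _*_)
open import Data.Fin using (Fin)
open import Relation.Binary.PropositionalEquality using (_≡_)

open import Data.Bool using (Bool; true; false; not)
open import Data.Bool.Properties using (not-involutive; not-injective; ∧-zeroʳ; T-≡)
open import Data.Empty using (⊥-elim)
open import Data.Fin using (toℕ) renaming (zero to fzero; suc to fsuc)
open import Data.List using (List; []; _∷_; _++_; concat; take; drop; length; tabulate)
open import Data.List.Properties using (++-assoc; concat-++; tabulate-cong)
open import Data.Nat using (zero; _+_; _∸_; _≤_; _<_; _%_; _≤ᵇ_; z≤n; s≤s)
open import Data.Nat.DivMod using (m%n<n; m*n%n≡0)
open import Data.Nat.GeneralisedArithmetic using (iterate)
open import Data.Nat.Properties
open import Function.Bundles using (Equivalence)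
open import Relation.Nullary using (contradiction)
open import Relation.Nullary.Reflects using (ofʸ)
open import Relation.Binary.PropositionalEquality
  using (_≢_; refl; sym; trans; cong; cong₂; subst; module ≡-Reasoning)

open ≡-Reasoning

module _ {A : Set} where

  take-length-++ : ∀ (xs ys : List A) j → take (length xs + j) (xs ++ ys) ≡ xs ++ take j ys
  take-length-++ []       ys j = refl
  take-length-++ (x ∷ xs) ys j = cong (x ∷_) (take-length-++ xs ys j)

  drop-length-++ : ∀ (xs ys : List A) j → drop (length xs + j) (xs ++ ys) ≡ drop j ys
  drop-length-++ []       ys j = refl
  drop-length-++ (x ∷ xs) ys j = drop-length-++ xs ys j

  take-++-≤ : ∀ (xs ys : List A) {j} → j ≤ length xs → take j (xs ++ ys) ≡ take j xs
  take-++-≤ xs       ys {zero}  _        = refl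
  take-++-≤ (x ∷ xs) ys {suc j} (s≤s j≤) = cong (x ∷_) (take-++-≤ xs ys j≤)

  drop-++-≤ : ∀ (xs ys : List A) {j} → j ≤ length xs → drop j (xs ++ ys) ≡ drop j xs ++ ys
  drop-++-≤ xs       ys {zero}  _        = refl
  drop-++-≤ (x ∷ xs) ys {suc j} (s≤s j≤) = drop-++-≤ xs ys j≤

  take-concat : ∀ {L P S : List (List A)} {B j} → L ≡ P ++ B ∷ S → j ≤ length B →
                take (length (concat P) + j) (concat L) ≡ concat P ++ take j B
  take-concat {P = P} {S} {B} {j} refl j≤ = begin
    take (length (concat P) + j) (concat (P ++ B ∷ S))
      ≡⟨ cong (take (length (concat P) + j)) (sym (concat-++ P (B ∷ S))) ⟩
    take (length (concat P) + j) (concat P ++ B ++ concat S)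
      ≡⟨ take-length-++ (concat P) _ j ⟩
    concat P ++ take j (B ++ concat S)
      ≡⟨ cong (concat P ++_) (take-++-≤ B _ j≤) ⟩
    concat P ++ take j B ∎

  drop-concat : ∀ {L P S : List (List A)} {B r} → L ≡ P ++ B ∷ S → r ≤ length B →
                drop (length (concat P) + r) (concat L) ≡ drop r B ++ concat S
  drop-concat {P = P} {S} {B} {r} refl r≤ = begin
    drop (length (concat P) + r) (concat (P ++ B ∷ S))
      ≡⟨ cong (drop (length (concat P) + r)) (sym (concat-++ P (B ∷ S))) ⟩
    drop (length (concat P) + r) (concat P ++ B ++ concat S)
      ≡⟨ drop-length-++ (concat P) _ r ⟩
    drop r (B ++ concat S)
      ≡⟨ drop-++-≤ B _ r≤ ⟩
    drop r B ++ concat S ∎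

  tabulate-split : ∀ {N} (f : Fin N → A) i →
                   tabulate f ≡ take (toℕ i) (tabulate f) ++ f i ∷ drop (suc (toℕ i)) (tabulate f)
  tabulate-split f fzero    = refl
  tabulate-split f (fsuc i) = cong (f fzero ∷_) (tabulate-split (λ j → f (fsuc j)) i)

  take-tabulate-cong : ∀ {N} {f g : Fin N → A} k → (∀ i → toℕ i < k → f i ≡ g i) →
                       take k (tabulate f) ≡ take k (tabulate g)
  take-tabulate-cong {zero}  zero    f≡g = refl
  take-tabulate-cong {zero}  (suc k) f≡g = refl
  take-tabulate-cong {suc N} zero    f≡g = refl
  take-tabulate-cong {suc N} (suc k) f≡g =
    cong₂ _∷_ (f≡g fzero (s≤s z≤n)) (take-tabulate-cong k (λ i i<k → f≡g (fsuc i) (s≤s i<k)))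

  drop-tabulate-cong : ∀ {N} {f g : Fin N → A} k → (∀ i → k ≤ toℕ i → f i ≡ g i) →
                       drop k (tabulate f) ≡ drop k (tabulate g)
  drop-tabulate-cong         zero    f≡g = tabulate-cong (λ i → f≡g i z≤n)
  drop-tabulate-cong {zero}  (suc k) f≡g = refl
  drop-tabulate-cong {suc N} (suc k) f≡g = drop-tabulate-cong k (λ i k≤i → f≡g (fsuc i) (s≤s k≤i))

iterate-+ : ∀ {A : Set} (f : A → A) x m n → iterate f x (m + n) ≡ iterate f (iterate f x m) n
iterate-+ f x zero    n = refl
iterate-+ f x (suc m) n = iterate-+ f (f x) m n

iterate-not-%2 : ∀ n x → iterate not x n ≡ iterate not x (n % 2)
iterate-not-%2 zero          x = refl
iterate-not-%2 (suc zero)    x = refl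
iterate-not-%2 (suc (suc n)) x = trans (cong (λ y → iterate not y n) (not-involutive x)) (iterate-not-%2 n x)

iterate-not-even : ∀ k x → iterate not x (2 * k) ≡ x
iterate-not-even k x = trans (iterate-not-%2 (2 * k) x)
  (cong (iterate not x) (trans (cong (_% 2) (*-comm 2 k)) (m*n%n≡0 k 2)))

iterate-not-injective : ∀ n {x y} → iterate not x n ≡ iterate not y n → x ≡ y
iterate-not-injective zero    eq = eq
iterate-not-injective (suc n) eq = not-injective (iterate-not-injective n eq)

iterate-not-opposite : ∀ {m n} x → m % 2 ≢ n % 2 → iterate not x n ≡ not (iterate not x m)
iterate-not-opposite {m} {n} x m≢n = begin
  iterate not x n             ≡⟨ iterate-not-%2 n x ⟩
  iterate not x (n % 2)       ≡⟨ residues (m%n<n m 2) (m%n<n n 2) m≢n ⟩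
  not (iterate not x (m % 2)) ≡⟨ cong not (sym (iterate-not-%2 m x)) ⟩
  not (iterate not x m)       ∎
  where
  residues : ∀ {r q} → r < 2 → q < 2 → r ≢ q → iterate not x q ≡ not (iterate not x r)
  residues {0} {0} _ _ r≢q = ⊥-elim (r≢q refl)
  residues {0} {1} _ _ _   = refl
  residues {1} {0} _ _ _   = sym (not-involutive x)
  residues {1} {1} _ _ r≢q = ⊥-elim (r≢q refl)
  residues {suc (suc _)} (s≤s (s≤s ())) _
  residues {_} {suc (suc _)} _ (s≤s (s≤s ()))

iterate-not-opposite-sum : ∀ {m n} x → m % 2 ≢ n % 2 → iterate not x (m + suc n) ≡ x
iterate-not-opposite-sum {m} {n} x m≢n = begin
  iterate not x (m + suc n)
    ≡⟨ iterate-+ not x m (suc n) ⟩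
  iterate not (not (iterate not x m)) n
    ≡⟨ cong (λ y → iterate not y n) (sym (iterate-not-opposite {m} {n} x m≢n)) ⟩
  iterate not (iterate not x n) n
    ≡⟨ sym (iterate-+ not x n n) ⟩
  iterate not x (n + n)
    ≡⟨ cong (λ k → iterate not x (n + k)) (sym (+-identityʳ n)) ⟩
  iterate not x (2 * n)
    ≡⟨ iterate-not-even n x ⟩
  x ∎

alternating : ℕ → Bool → List Bool
alternating zero    x = []
alternating (suc k) x = x ∷ alternating k (not x)

length-alternating : ∀ k x → length (alternating k x) ≡ k
length-alternating zero    x = refl
length-alternating (suc k) x = cong suc (length-alternating k (not x))

alternating-+ : ∀ i j x → alternating (i + j) x ≡ alternating i x ++ alternating j (iterate not x i)
alternating-+ zero    j x = refl
alternating-+ (suc i) j x = cong (x ∷_) (alternating-+ i j (not x))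

take-alternating : ∀ {j k} x → j ≤ k → take j (alternating k x) ≡ alternating j x
take-alternating x z≤n       = refl
take-alternating x (s≤s j≤k) = cong (x ∷_) (take-alternating (not x) j≤k)

drop-alternating : ∀ i j x → drop i (alternating (i + j) x) ≡ alternating j (iterate not x i)
drop-alternating zero    j x = refl
drop-alternating (suc i) j x = drop-alternating i j (not x)

rep-alternating : ∀ k x → rep k x (not x) ≡ alternating (2 * k) x
rep-alternating zero    x = refl
rep-alternating (suc k) x = begin
  x ∷ not x ∷ rep k x (not x)
    ≡⟨ cong (λ w → x ∷ not x ∷ w) (rep-alternating k x) ⟩
  x ∷ not x ∷ alternating (2 * k) x
    ≡⟨ cong (λ y → x ∷ not x ∷ alternating (2 * k) y) (sym (not-involutive x)) ⟩
  alternating (2 + 2 * k) x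
    ≡⟨ cong (λ n → alternating n x) (sym (*-suc 2 k)) ⟩
  alternating (2 * suc k) x ∎

alternating-splice : ∀ x {L K} l m → l < L → m < 2 * K → l % 2 ≢ m % 2 →
  take (suc l) (alternating L x) ++ drop (2 * K ∸ m ∸ 1) (alternating (2 * K) (not x))
  ≡ alternating (suc l + suc m) x
alternating-splice x {L} {K} l m l<L m<2K l≢m = begin
  take (suc l) (alternating L x) ++ drop d (alternating (2 * K) (not x))
    ≡⟨ cong₂ _++_ (take-alternating x l<L)
                  (trans (cong (λ k → drop d (alternating k (not x))) (sym d+suc-m≡2K))
                         (drop-alternating d (suc m) (not x))) ⟩
  alternating (suc l) x ++ alternating (suc m) (iterate not (not x) d)
    ≡⟨ cong (λ y → alternating (suc l) x ++ alternating (suc m) y) phase ⟩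
  alternating (suc l) x ++ alternating (suc m) (iterate not x (suc l))
    ≡⟨ sym (alternating-+ (suc l) (suc m) x) ⟩
  alternating (suc l + suc m) x ∎
  where
  d : ℕ
  d = 2 * K ∸ m ∸ 1
  d+suc-m≡2K : d + suc m ≡ 2 * K
  d+suc-m≡2K = trans (cong (_+ suc m) (trans (∸-+-assoc (2 * K) m 1) (cong (2 * K ∸_) (+-comm m 1))))
                     (m∸n+n≡m m<2K)
  -- d and l are both ≡ m+1 modulo 2, so they shift the phase of not x alike.
  phase : iterate not (not x) d ≡ iterate not (not x) l
  phase = iterate-not-injective (suc m) (begin
    iterate not (iterate not (not x) d) (suc m) ≡⟨ sym (iterate-+ not (not x) d (suc m)) ⟩
    iterate not (not x) (d + suc m)             ≡⟨ cong (iterate not (not x)) d+suc-m≡2K ⟩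
    iterate not (not x) (2 * K)                 ≡⟨ iterate-not-even K (not x) ⟩
    not x                                       ≡⟨ sym (iterate-not-opposite-sum {l} {m} (not x) l≢m) ⟩
    iterate not (not x) (l + suc m)             ≡⟨ iterate-+ not (not x) l (suc m) ⟩
    iterate not (iterate not (not x) l) (suc m) ∎)

block-alternating : ∀ j k → block j k ≡ alternating (2 * suc k) (iterate not false j)
block-alternating j k rewrite iterate-not-%2 j false with j % 2 | m%n<n j 2
... | 0           | _                = rep-alternating (suc k) false
... | 1           | _                = rep-alternating (suc k) true
... | suc (suc _) | s≤s (s≤s ())

length-block : ∀ j k → length (block j k) ≡ 2 * suc k
length-block j k = trans (cong length (block-alternating j k)) (length-alternating _ _)

block-splice : ∀ s t l m {bs bt} → s % 2 ≢ t % 2 → l % 2 ≢ m % 2 →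
  l < 2 * suc bs → m < 2 * suc bt →
  take (suc l) (block s bs) ++ drop (2 * suc bt ∸ m ∸ 1) (block t bt)
  ≡ alternating (suc l + suc m) (iterate not false s)
block-splice s t l m {bs} {bt} s≢t l≢m l< m<
  rewrite block-alternating s bs | block-alternating t bt | iterate-not-opposite {s} {t} false s≢t
  = alternating-splice (iterate not false s) {K = suc bt} l m l< m< l≢m

block-splice-swap : ∀ s t l m {bs bt} → s % 2 ≢ t % 2 → l % 2 ≢ m % 2 →
  l < 2 * suc bs → m < 2 * suc bt →
  take (suc l) (block s bs) ++ drop (2 * suc bt ∸ m ∸ 1) (block t bt)
  ≡ take (suc m) (block s bt) ++ drop (2 * suc bs ∸ l ∸ 1) (block t bs)
block-splice-swap s t l m {bs} {bt} s≢t l≢m l< m< = begin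
  take (suc l) (block s bs) ++ drop (2 * suc bt ∸ m ∸ 1) (block t bt)
    ≡⟨ block-splice s t l m s≢t l≢m l< m< ⟩
  alternating (suc l + suc m) (iterate not false s)
    ≡⟨ cong (λ k → alternating k (iterate not false s)) (+-comm (suc l) (suc m)) ⟩
  alternating (suc m + suc l) (iterate not false s)
    ≡⟨ sym (block-splice s t m l s≢t (λ m≡l → l≢m (sym m≡l)) m< l<) ⟩
  take (suc m) (block s bt) ++ drop (2 * suc bs ∸ l ∸ 1) (block t bs) ∎

lookupℕ-toℕ : ∀ {N} (b : Fin N → ℕ) i → lookupℕ N b (toℕ i) ≡ b i
lookupℕ-toℕ b fzero    = refl
lookupℕ-toℕ b (fsuc i) = lookupℕ-toℕ (λ j → b (fsuc j)) i

≤ᵇ-true : ∀ {m n} → m ≤ n → (m ≤ᵇ n) ≡ true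
≤ᵇ-true m≤n = Equivalence.to T-≡ (≤⇒≤ᵇ m≤n)

≤ᵇ-false : ∀ {m n} → n < m → (m ≤ᵇ n) ≡ false
≤ᵇ-false {m} {n} n<m with m ≤ᵇ n | ≤ᵇ-reflects-≤ m n
... | false | _       = refl
... | true  | ofʸ m≤n = contradiction m≤n (<⇒≱ n<m)

revIdx-< : ∀ {s t i} → i < s → revIdx s t i ≡ i
revIdx-< i<s rewrite ≤ᵇ-false i<s = refl

revIdx-> : ∀ {s t i} → t < i → revIdx s t i ≡ i
revIdx-> {s} {t} {i} t<i rewrite ≤ᵇ-false t<i | ∧-zeroʳ (s ≤ᵇ i) = refl

revIdx-left : ∀ {s t} → s ≤ t → revIdx s t s ≡ t
revIdx-left {s} {t} s≤t rewrite ≤ᵇ-true (≤-refl {s}) | ≤ᵇ-true s≤t = m+n∸m≡n s t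

revIdx-right : ∀ {s t} → s ≤ t → revIdx s t t ≡ s
revIdx-right {s} {t} s≤t rewrite ≤ᵇ-true s≤t | ≤ᵇ-true (≤-refl {t}) = m+n∸n≡m s t

reverseSeg-lookup : ∀ n (b : Fin (suc (2 * n)) → ℕ) s t i j →
  revIdx (toℕ s) (toℕ t) (toℕ i) ≡ toℕ j → reverseSeg n b s t i ≡ b j
reverseSeg-lookup n b s t i j eq = trans (cong (lookupℕ (suc (2 * n)) b) eq) (lookupℕ-toℕ b j)

reverseSeg-left : ∀ n b s t → toℕ s ≤ toℕ t → reverseSeg n b s t s ≡ b t
reverseSeg-left n b s t s≤t = reverseSeg-lookup n b s t s t (revIdx-left s≤t)

reverseSeg-right : ∀ n b s t → toℕ s ≤ toℕ t → reverseSeg n b s t t ≡ b s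
reverseSeg-right n b s t s≤t = reverseSeg-lookup n b s t t s (revIdx-right s≤t)

take-blocks-reverseSeg : ∀ n b s t →
  take (toℕ s) (blocks n (reverseSeg n b s t)) ≡ take (toℕ s) (blocks n b)
take-blocks-reverseSeg n b s t = take-tabulate-cong (toℕ s)
  (λ i i<s → cong (block (toℕ i)) (reverseSeg-lookup n b s t i i (revIdx-< i<s)))

drop-blocks-reverseSeg : ∀ n b s t →
  drop (suc (toℕ t)) (blocks n (reverseSeg n b s t)) ≡ drop (suc (toℕ t)) (blocks n b)
drop-blocks-reverseSeg n b s t = drop-tabulate-cong (suc (toℕ t))
  (λ i t<i → cong (block (toℕ i)) (reverseSeg-lookup n b s t i i (revIdx-> t<i)))

quotientSeq-split : ∀ n b s l t m → l < 2 * suc (b s) → m < 2 * suc (b t) →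
  quotientSeq n b s l t m
  ≡ concat (take (toℕ s) (blocks n b))
    ++ (take (suc l) (block (toℕ s) (b s)) ++ drop (2 * suc (b t) ∸ m ∸ 1) (block (toℕ t) (b t)))
    ++ concat (drop (suc (toℕ t)) (blocks n b))
quotientSeq-split n b s l t m l<2bs m<2bt = begin
  take (suc (offset n b (toℕ s) + l)) (W n b) ++ drop (offset n b (toℕ t) + K ∸ m ∸ 1) (W n b)
    ≡⟨ cong₂ _++_ prefix suffix ⟩
  (P ++ take (suc l) Bs) ++ (drop r Bt ++ S)
    ≡⟨ ++-assoc P _ _ ⟩
  P ++ take (suc l) Bs ++ drop r Bt ++ S
    ≡⟨ cong (P ++_) (sym (++-assoc (take (suc l) Bs) (drop r Bt) S)) ⟩
  P ++ (take (suc l) Bs ++ drop r Bt) ++ S ∎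
  where
  K r : ℕ
  K = 2 * suc (b t)
  r = K ∸ m ∸ 1
  Bs Bt P S : List Bool
  Bs = block (toℕ s) (b s)
  Bt = block (toℕ t) (b t)
  P  = concat (take (toℕ s) (blocks n b))
  S  = concat (drop (suc (toℕ t)) (blocks n b))
  blocks-split : ∀ i →
    blocks n b ≡ take (toℕ i) (blocks n b) ++ block (toℕ i) (b i) ∷ drop (suc (toℕ i)) (blocks n b)
  blocks-split = tabulate-split (λ i → block (toℕ i) (b i))
  r≤K : r ≤ K
  r≤K = ≤-trans (m∸n≤m (K ∸ m) 1) (m∸n≤m K m)
  prefix : take (suc (offset n b (toℕ s) + l)) (W n b) ≡ P ++ take (suc l) Bs
  prefix = trans (cong (λ k → take k (W n b)) (sym (+-suc (offset n b (toℕ s)) l)))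
                 (take-concat (blocks-split s)
                   (subst (suc l ≤_) (sym (length-block (toℕ s) (b s))) l<2bs))
  suffix : drop (offset n b (toℕ t) + K ∸ m ∸ 1) (W n b) ≡ drop r Bt ++ S
  suffix = trans (cong (λ k → drop k (W n b))
                   (trans (cong (_∸ 1) (+-∸-assoc (offset n b (toℕ t)) (<⇒≤ m<2bt)))
                          (+-∸-assoc (offset n b (toℕ t)) (m<n⇒0<n∸m m<2bt))))
                 (drop-concat (blocks-split t) (subst (r ≤_) (sym (length-block (toℕ t) (b t))) r≤K))

mainTheorem9 : (n : ℕ) (b : Fin (suc (2 * n)) → ℕ) (s : Fin (suc (2 * n))) (l : ℕ)
    (t : Fin (suc (2 * n))) (m : ℕ) → OddEncoding n b s l t m →
    quotientSeq n b s l t m ≡ quotientSeq n (reverseSeg n b s t) s m t l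
mainTheorem9 n b s l t m enc =
  trans (quotientSeq-split n b s l t m l-bound m-bound)
  (trans (cong₂ _++_ (cong concat (sym (take-blocks-reverseSeg n b s t)))
                     (cong₂ _++_ middle (cong concat (sym (drop-blocks-reverseSeg n b s t)))))
         (sym (quotientSeq-split n c s m t l m<2cs l<2ct)))
  where
  open OddEncoding enc
  c : Fin (suc (2 * n)) → ℕ
  c = reverseSeg n b s t
  c-s≡b-t : c s ≡ b t
  c-s≡b-t = reverseSeg-left n b s t (<⇒≤ s<t)
  c-t≡b-s : c t ≡ b s
  c-t≡b-s = reverseSeg-right n b s t (<⇒≤ s<t)
  m<2cs : m < 2 * suc (c s)
  m<2cs = subst (λ k → m < 2 * suc k) (sym c-s≡b-t) m-bound
  l<2ct : l < 2 * suc (c t)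
  l<2ct = subst (λ k → l < 2 * suc k) (sym c-t≡b-s) l-bound
  middle : take (suc l) (block (toℕ s) (b s)) ++ drop (2 * suc (b t) ∸ m ∸ 1) (block (toℕ t) (b t))
         ≡ take (suc m) (block (toℕ s) (c s)) ++ drop (2 * suc (c t) ∸ l ∸ 1) (block (toℕ t) (c t))
  middle = trans (block-splice-swap (toℕ s) (toℕ t) l m st-parity lm-parity l-bound m-bound)
    (cong₂ (λ x y → take (suc m) (block (toℕ s) x) ++ drop (2 * suc y ∸ l ∸ 1) (block (toℕ t) y))
           (sym c-s≡b-t) (sym c-t≡b-s))
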